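{- Let $A$ be a finite simple connected graph which is both distance degree regular and LC. Then for every integer $n\ge 1$ the Cartesian power $A^{\square n}$ is distance degree regular and LC.
   Context: A finite sequence $(s_0,\dots,s_d)$ of nonnegative integers is log-concave if $s_i^2 \ge s_{i-1}s_{i+1}$ for every $1 \le i \le d-1$. For a vertex $x$ of a graph $G$ of diameter $d$, let $G_i(x)$ be the set of vertices at geodetic distance exactly $i$ from $x$. $G$ is distance degree regular if for every $0\le i\le d$ the number $|G_i(x)|$ does not depend on $x$. $G$ is called LC if it has at least one vertex $x$ such that $(|G_i(x)|)_{0\le i\le d}$ is log-concave. The Cartesian product $G\square H$ has vertex set $V(G)\times V(H)$, with $(u,v)\sim(u',v')$ iff either $u=u'$ and $v\sim v'$ in $H$, or $v=v'$ and $u\sim u'$ in $G$. The Cartesian power is defined by $A^{\square 1}=A$ and $A^{\square n}=A^{\square (n-1)}\square A$. -}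

module Defs where

open import Data.Nat using (ℕ; zero; suc; _+_; _*_; _∸_; _≤_)
open import Data.Bool using (Bool; true; false; _∧_; _∨_; not; if_then_else_)
open import Data.Fin using (Fin; remQuot; _≟_)
open import Data.List using (List; map; allFin)
open import Data.Bool.ListAction using (any)
open import Data.Nat.ListAction using (sum)
open import Data.Product using (Σ; ∃; ∃₂; _×_; _,_; proj₁; proj₂)
open import Relation.Binary.PropositionalEquality using (_≡_)
open import Relation.Nullary.Decidable using (⌊_⌋)

record Graph : Set where
  field
    order : ℕ
    adj   : Fin order → Fin order → Bool
open Graph public

Simple : Graph → Set
Simple G = (∀ x y → adj G x y ≡ adj G y x) × (∀ x → adj G x x ≡ false)

reach : (G : Graph) → ℕ → Fin (order G) → Fin (order G) → Bool
reach G zero    x y = ⌊ x ≟ y ⌋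
reach G (suc k) x y = reach G k x y ∨ any (λ z → adj G x z ∧ reach G k z y) (allFin (order G))

Connected : Graph → Set
Connected G = ∀ x y → ∃ λ k → reach G k x y ≡ true

atDist : (G : Graph) → ℕ → Fin (order G) → Fin (order G) → Bool
atDist G zero    x y = reach G zero x y
atDist G (suc i) x y = reach G (suc i) x y ∧ not (reach G i x y)

sphere : (G : Graph) → ℕ → Fin (order G) → ℕ
sphere G i x = sum (map (λ y → if atDist G i x y then 1 else 0) (allFin (order G)))

IsDiameter : Graph → ℕ → Set
IsDiameter G d = (∀ x y → reach G d x y ≡ true) × ∃₂ λ x y → atDist G d x y ≡ true

LogConcave : ℕ → (ℕ → ℕ) → Set
LogConcave d s = ∀ i → 1 ≤ i → suc i ≤ d → s (i ∸ 1) * s (suc i) ≤ s i * s i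

DistanceDegreeRegular : Graph → Set
DistanceDegreeRegular G =
  ∀ d → IsDiameter G d → ∀ i → i ≤ d → ∀ x y → sphere G i x ≡ sphere G i y

LC : Graph → Set
LC G = Σ (Fin (order G)) λ x → ∀ d → IsDiameter G d → LogConcave d (λ i → sphere G i x)

-- Cartesian product; vertex (u , v) of G □ H is encoded in Fin (|G| * |H|) via remQuot
_□_ : Graph → Graph → Graph
G □ H = record
  { order = order G * order H
  ; adj   = λ p q → let (u , v) = remQuot (order H) p ; (u' , v') = remQuot (order H) q in
                    (⌊ u ≟ u' ⌋ ∧ adj H v v') ∨ (⌊ v ≟ v' ⌋ ∧ adj G u u')
  }

-- Cartesian power: A ^□ 1 = A, A ^□ (n+1) = (A ^□ n) □ A.  (A ^□ 0 is junk := A, never used.)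
_^□_ : Graph → ℕ → Graph
A ^□ zero          = A
A ^□ suc zero      = A
A ^□ suc (suc n)   = (A ^□ suc n) □ A

{-# OPTIONS --safe #-}

-- Distances add up in a Cartesian product, so the sphere sizes of G □ H around (u , v) are the
-- convolution of those of G around u with those of H around v; hence the product of two distance
-- degree regular graphs is distance degree regular. A sphere sequence has no internal zeros (walk
-- back along a geodesic realising the diameter), and the convolution of two log-concave sequences
-- without internal zeros is log-concave: writing conv s t as the row vector s times the
-- lower-triangular Toeplitz matrix of t, both factors have nonnegative adjacent 2 × 2 minors, and a
-- two-row Cauchy–Binet argument, i.e. a symmetrised rearrangement inequality, passes this on to the
-- product.

module Submission where

open import Defs
open import Data.Nat
  using (ℕ; zero; suc; _+_; _*_; _∸_; _≤_; _<_; _≤′_; ≤′-refl; ≤′-step; z≤n; s≤s; >-nonZero; _≤?_)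
open import Data.Nat.Properties
open import Data.Nat.Solver using (module +-*-Solver)
open import Data.Bool using (Bool; true; false; _∧_; _∨_; not; if_then_else_)
import Data.Bool as Bool
open import Data.Bool.Properties using (¬-not; T-≡; ∧-conicalˡ; ∧-conicalʳ; ∨-zeroʳ)
open import Data.Bool.ListAction using (any)
open import Data.Fin as Fin using (Fin; zero; suc; toℕ; combine; remQuot; _↑ˡ_; _↑ʳ_)
open import Data.Fin.Properties using (remQuot-combine; combine-remQuot; all?; ¬∀⟶∃¬)
open import Data.List using (tabulate; allFin)
open import Data.List.Properties using (map-tabulate)
open import Data.List.Relation.Unary.Any.Properties using (any⁺; any⁻; tabulate⁺; tabulate⁻)
open import Function.Bundles using (Equivalence)
import Data.Nat.ListAction as List
open import Data.Product using (∃; ∃₂; _×_; _,_; proj₁; proj₂)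
open import Data.Sum using (_⊎_; inj₁; inj₂)
open import Function using (_∘_)
open import Relation.Binary.PropositionalEquality
open import Relation.Nullary using (¬_; Dec; yes; no; contradiction)
open import Relation.Nullary.Decidable using (⌊_⌋; toWitness; fromWitness)
open import Algebra.Properties.Semiring.Sum +-*-semiring
  using ( sum; sum-syntax; sum-cong-≗; sum-replicate-zero; ∑-distrib-+; ∑-comm
        ; *-distribˡ-sum; *-distribʳ-sum)

-- Finite sums

sum-tabulate : ∀ {n} (f : Fin n → ℕ) → List.sum (tabulate f) ≡ sum f
sum-tabulate {zero}  f = refl
sum-tabulate {suc n} f = cong (f zero +_) (sum-tabulate (f ∘ suc))

sum-zero : ∀ {n} (f : Fin n → ℕ) → (∀ i → f i ≡ 0) → sum f ≡ 0
sum-zero {n} f f≗0 = trans (sum-cong-≗ f≗0) (sum-replicate-zero n)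

sum-mono-≤ : ∀ {n} {f g : Fin n → ℕ} → (∀ i → f i ≤ g i) → sum f ≤ sum g
sum-mono-≤ {zero}  f≤g = z≤n
sum-mono-≤ {suc n} f≤g = +-mono-≤ (f≤g zero) (sum-mono-≤ (f≤g ∘ suc))

term≤sum : ∀ {n} (f : Fin n → ℕ) i → f i ≤ sum f
term≤sum f zero    = m≤m+n _ _
term≤sum f (suc i) = ≤-trans (term≤sum (f ∘ suc) i) (m≤n+m _ _)

sum-↑ : ∀ m {n} (f : Fin (m + n) → ℕ) → sum f ≡ sum (f ∘ (_↑ˡ n)) + sum (f ∘ (m ↑ʳ_))
sum-↑ zero    f = refl
sum-↑ (suc m) f = trans (cong (f zero +_) (sum-↑ m (f ∘ suc))) (sym (+-assoc (f zero) _ _))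

sum-combine : ∀ m {n} (f : Fin (m * n) → ℕ) → sum f ≡ ∑[ i < m ] ∑[ j < n ] f (combine i j)
sum-combine zero        f = refl
sum-combine (suc m) {n} f =
  trans (sum-↑ n f) (cong (sum (λ j → f (j ↑ˡ m * n)) +_) (sum-combine m (f ∘ (n ↑ʳ_))))

sum*sum : ∀ {m n} (f : Fin m → ℕ) (g : Fin n → ℕ) → sum f * sum g ≡ ∑[ i < m ] ∑[ j < n ] (f i * g j)
sum*sum f g = trans (*-distribʳ-sum (sum g) f) (sum-cong-≗ (λ i → *-distribˡ-sum (f i) g))

∑∑-symmetrise : ∀ {n} (f : Fin n → Fin n → ℕ) →
  ∑[ i < n ] ∑[ j < n ] (f i j + f j i) ≡ 2 * ∑[ i < n ] ∑[ j < n ] f i j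
∑∑-symmetrise {n} f = begin
    ∑[ i < n ] ∑[ j < n ] (f i j + f j i)
  ≡⟨ sum-cong-≗ (λ i → ∑-distrib-+ (f i) (λ j → f j i)) ⟩
    ∑[ i < n ] (∑[ j < n ] f i j + ∑[ j < n ] f j i)
  ≡⟨ ∑-distrib-+ (λ i → ∑[ j < n ] f i j) (λ i → ∑[ j < n ] f j i) ⟩
    S + ∑[ i < n ] ∑[ j < n ] f j i
  ≡⟨ cong (S +_) (sym (∑-comm f)) ⟩
    S + S
  ≡⟨ cong (S +_) (sym (+-identityʳ S)) ⟩
    2 * S ∎
  where
  open ≡-Reasoning
  S = ∑[ i < n ] ∑[ j < n ] f i j

∑∑-mono-symmetric : ∀ {n} (f g : Fin n → Fin n → ℕ) → (∀ i j → f i j + f j i ≤ g i j + g j i) →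
  ∑[ i < n ] ∑[ j < n ] f i j ≤ ∑[ i < n ] ∑[ j < n ] g i j
∑∑-mono-symmetric f g f≤g = *-cancelˡ-≤ 2
  (subst₂ _≤_ (∑∑-symmetrise f) (∑∑-symmetrise g) (sum-mono-≤ (λ i → sum-mono-≤ (f≤g i))))

∑< : ℕ → (ℕ → ℕ) → ℕ
∑< n f = ∑[ i < n ] f (toℕ i)

∑<-cong : ∀ n {f g : ℕ → ℕ} → (∀ a → f a ≡ g a) → ∑< n f ≡ ∑< n g
∑<-cong n {f} {g} f≗g = sum-cong-≗ {n} {f ∘ toℕ} {g ∘ toℕ} (f≗g ∘ toℕ)

-- Convolution of log-concave sequences

δ : ℕ → ℕ → ℕ
δ zero    zero    = 1
δ zero    (suc i) = 0
δ (suc p) zero    = 0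
δ (suc p) (suc i) = δ p i

δ-diag : ∀ p → δ p p ≡ 1
δ-diag zero    = refl
δ-diag (suc p) = δ-diag p

δ-off : ∀ {p i} → i ≢ p → δ p i ≡ 0
δ-off {zero}  {zero}  i≢p = contradiction refl i≢p
δ-off {zero}  {suc i} _   = refl
δ-off {suc p} {zero}  _   = refl
δ-off {suc p} {suc i} i≢p = δ-off (i≢p ∘ cong suc)

conv : (ℕ → ℕ) → (ℕ → ℕ) → ℕ → ℕ
conv s t k = ∑< (suc k) (λ a → s a * t (k ∸ a))

conv-cong : ∀ {s s' t t' : ℕ → ℕ} → (∀ a → s a ≡ s' a) → (∀ b → t b ≡ t' b) →
  ∀ k → conv s t k ≡ conv s' t' k
conv-cong s≗s' t≗t' k = ∑<-cong (suc k) (λ a → cong₂ _*_ (s≗s' a) (t≗t' (k ∸ a)))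

conv-δ : ∀ p q i → conv (δ p) (δ q) i ≡ δ (p + q) i
conv-δ zero    q i       = trans (cong₂ _+_ (*-identityˡ (δ q i)) (sum-replicate-zero i)) (+-identityʳ _)
conv-δ (suc p) q zero    = refl
conv-δ (suc p) q (suc i) = conv-δ p q i

conv-∑∑ : ∀ {m n} (f : Fin m → ℕ → ℕ) (g : Fin n → ℕ → ℕ) k →
  ∑[ i < m ] ∑[ j < n ] conv (f i) (g j) k ≡ conv (λ a → ∑[ i < m ] f i a) (λ b → ∑[ j < n ] g j b) k
conv-∑∑ {m} {n} f g k = begin
    ∑[ i < m ] ∑[ j < n ] ∑[ a < suc k ] term i j a
  ≡⟨ sum-cong-≗ {m} {λ i → ∑[ j < n ] ∑[ a < suc k ] term i j a} (λ i → ∑-comm (term i)) ⟩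
    ∑[ i < m ] ∑[ a < suc k ] ∑[ j < n ] term i j a
  ≡⟨ ∑-comm (λ i a → ∑[ j < n ] term i j a) ⟩
    ∑[ a < suc k ] ∑[ i < m ] ∑[ j < n ] term i j a
  ≡⟨ sum-cong-≗ {suc k} {λ a → ∑[ i < m ] ∑[ j < n ] term i j a}
       (λ a → sym (sum*sum (λ i → f i (toℕ a)) (λ j → g j (k ∸ toℕ a)))) ⟩
    conv (λ a → ∑[ i < m ] f i a) (λ b → ∑[ j < n ] g j b) k ∎
  where
  open ≡-Reasoning
  term : Fin m → Fin n → Fin (suc k) → ℕ
  term i j a = f i (toℕ a) * g j (k ∸ toℕ a)

toeplitz : (ℕ → ℕ) → ℕ → ℕ → ℕ
toeplitz t k       zero    = t k
toeplitz t zero    (suc a) = 0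
toeplitz t (suc k) (suc a) = toeplitz t k a

toeplitz-≤ : ∀ t {k a} → a ≤ k → toeplitz t k a ≡ t (k ∸ a)
toeplitz-≤ t {k}     {zero}  _         = refl
toeplitz-≤ t {suc k} {suc a} (s≤s a≤k) = toeplitz-≤ t a≤k

toeplitz-> : ∀ t {k a} → k < a → toeplitz t k a ≡ 0
toeplitz-> t {zero}  {suc a} _         = refl
toeplitz-> t {suc k} {suc a} (s≤s k<a) = toeplitz-> t k<a

conv-toeplitz : ∀ s t {k n} → k < n → conv s t k ≡ ∑< n (λ a → s a * toeplitz t k a)
conv-toeplitz s t {zero}  {suc n} _ =
  cong (s 0 * t 0 +_) (sym (sum-zero {n} (λ a → s (suc (toℕ a)) * 0) (λ a → *-zeroʳ (s (suc (toℕ a))))))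
conv-toeplitz s t {suc k} {suc n} (s≤s k<n) =
  cong (s 0 * t (suc k) +_) (conv-toeplitz (s ∘ suc) t k<n)

-- i ↦ g i / f i is antitone, cross-multiplied so that f may vanish.
AntitoneRatio : (ℕ → ℕ) → (ℕ → ℕ) → Set
AntitoneRatio f g = ∀ {i j} → i ≤ j → f i * g j ≤ g i * f j

rearrangement : ∀ {x X u U} → x ≤ X → u ≤ U → x * U + X * u ≤ X * U + x * u
rearrangement {x} {X} {u} {U} x≤X u≤U with m≤n⇒∃[o]m+o≡n x≤X | m≤n⇒∃[o]m+o≡n u≤U
... | d , refl | e , refl = subst (x * (u + e) + (x + d) * u ≤_) identity (m≤m+n _ (d * e))
  where
  open +-*-Solver
  identity : x * (u + e) + (x + d) * u + d * e ≡ (x + d) * (u + e) + x * u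
  identity = solve 4 (λ x d u e → x :* (u :+ e) :+ (x :+ d) :* u :+ d :* e := (x :+ d) :* (u :+ e) :+ x :* u)
                     refl x d u e

-- Two-row Cauchy–Binet: in the expanded products, the (i , j) and (j , i) terms together form an
-- instance of the rearrangement inequality.
∑<-antitoneRatio : ∀ n {a b u v : ℕ → ℕ} → AntitoneRatio a b → AntitoneRatio v u →
  ∑< n (λ i → a i * u i) * ∑< n (λ i → b i * v i) ≤ ∑< n (λ i → b i * u i) * ∑< n (λ i → a i * v i)
∑<-antitoneRatio n {a} {b} {u} {v} ab vu = begin
    ∑< n (λ i → a i * u i) * ∑< n (λ i → b i * v i)
  ≡⟨ sum*sum {n} {n} (λ i → a (toℕ i) * u (toℕ i)) (λ j → b (toℕ j) * v (toℕ j)) ⟩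
    ∑[ i < n ] ∑[ j < n ] f (toℕ i) (toℕ j)
  ≤⟨ ∑∑-mono-symmetric {n} (λ i j → f (toℕ i) (toℕ j)) (λ i j → g (toℕ i) (toℕ j))
                           (λ i j → pair (toℕ i) (toℕ j)) ⟩
    ∑[ i < n ] ∑[ j < n ] g (toℕ i) (toℕ j)
  ≡⟨ sum*sum {n} {n} (λ i → b (toℕ i) * u (toℕ i)) (λ j → a (toℕ j) * v (toℕ j)) ⟨
    ∑< n (λ i → b i * u i) * ∑< n (λ i → a i * v i) ∎
  where
  open ≤-Reasoning
  f g : ℕ → ℕ → ℕ
  f i j = (a i * u i) * (b j * v j)
  g i j = (b i * u i) * (a j * v j)
  ordered : ∀ {i j} → i ≤ j → f i j + f j i ≤ g i j + g j i
  ordered {i} {j} i≤j = subst₂ _≤_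
    (solve 8 (λ ai bi ui vi aj bj uj vj →
       (ai :* bj) :* (ui :* vj) :+ (bi :* aj) :* (vi :* uj)
         := (ai :* ui) :* (bj :* vj) :+ (aj :* uj) :* (bi :* vi))
       refl (a i) (b i) (u i) (v i) (a j) (b j) (u j) (v j))
    (solve 8 (λ ai bi ui vi aj bj uj vj →
       (bi :* aj) :* (ui :* vj) :+ (ai :* bj) :* (vi :* uj)
         := (bi :* ui) :* (aj :* vj) :+ (bj :* uj) :* (ai :* vi))
       refl (a i) (b i) (u i) (v i) (a j) (b j) (u j) (v j))
    (rearrangement (ab i≤j) (vu i≤j))
    where open +-*-Solver
  pair : ∀ i j → f i j + f j i ≤ g i j + g j i
  pair i j with ≤-total i j
  ... | inj₁ i≤j = ordered i≤j
  ... | inj₂ j≤i = subst₂ _≤_ (+-comm (f j i) (f i j)) (+-comm (g j i) (g i j)) (ordered j≤i)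

record PositiveLC (D : ℕ) (s : ℕ → ℕ) : Set where
  field
    positive   : ∀ {i} → i ≤ D → 0 < s i
    vanish     : ∀ {i} → D < i → s i ≡ 0
    logConcave : LogConcave D s

LogConcave-cong : ∀ {d s s'} → (∀ i → s i ≡ s' i) → LogConcave d s → LogConcave d s'
LogConcave-cong s≗s' lc i 1≤i i<d =
  subst₂ _≤_ (cong₂ _*_ (s≗s' _) (s≗s' _)) (cong₂ _*_ (s≗s' i) (s≗s' i)) (lc i 1≤i i<d)

ratio-≤-trans : ∀ {a b c d e f} → 0 < b → 0 < d → a * b ≤ c * d → d * e ≤ b * f → a * e ≤ c * f
ratio-≤-trans {a} {b} {c} {d} {e} {f} 0<b 0<d ab≤cd de≤bf =
  *-cancelˡ-≤ (b * d) {{>-nonZero (*-mono-< 0<b 0<d)}}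
  (subst₂ _≤_ (solve 6 (λ a b c d e f → (a :* b) :* (d :* e) := (b :* d) :* (a :* e)) refl a b c d e f)
              (solve 6 (λ a b c d e f → (c :* d) :* (b :* f) := (b :* d) :* (c :* f)) refl a b c d e f)
              (*-mono-≤ ab≤cd de≤bf))
  where open +-*-Solver

module _ {D s} (hs : PositiveLC D s) where
  open PositiveLC hs

  ratio-antitone : ∀ {p q} → p ≤ q → s p * s (suc q) ≤ s (suc p) * s q
  ratio-antitone p≤q = go (≤⇒≤′ p≤q)
    where
    go : ∀ {p q} → p ≤′ q → s p * s (suc q) ≤ s (suc p) * s q
    go {p} ≤′-refl = ≤-reflexive (*-comm (s p) (s (suc p)))
    go {p} (≤′-step {q} p≤q) with suc (suc q) ≤? D
    ... | yes q+2≤D = ratio-≤-trans {a = s p} {c = s (suc p)}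
      (positive (<⇒≤ q+2≤D)) (positive (≤-trans (n≤1+n q) (<⇒≤ q+2≤D)))
      (go p≤q) (logConcave (suc q) (s≤s z≤n) q+2≤D)
    ... | no  q+2≰D rewrite vanish (≰⇒> q+2≰D) | *-zeroʳ (s p) = z≤n

  shift-antitoneRatio : AntitoneRatio (λ i → toeplitz s i 1) s
  shift-antitoneRatio {zero}  {j}     _         = z≤n
  shift-antitoneRatio {suc p} {suc q} (s≤s p≤q) = ratio-antitone p≤q

  -- On and below the diagonal this is ratio-antitone at k ∸ j ≤ k ∸ i.
  toeplitz-antitoneRatio : ∀ k → AntitoneRatio (toeplitz s (suc k)) (toeplitz s k)
  toeplitz-antitoneRatio k {i} {j} i≤j with j ≤? k
  ... | no  j≰k rewrite toeplitz-> s (≰⇒> j≰k) | *-zeroʳ (toeplitz s (suc k) i) = z≤n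
  ... | yes j≤k
    rewrite toeplitz-≤ s (≤-trans i≤j j≤k) | toeplitz-≤ s j≤k
          | toeplitz-≤ s (≤-trans (≤-trans i≤j j≤k) (n≤1+n k)) | toeplitz-≤ s (≤-trans j≤k (n≤1+n k))
          | +-∸-assoc 1 j≤k | +-∸-assoc 1 (≤-trans i≤j j≤k)
    = subst₂ _≤_ (*-comm (s (k ∸ j)) _) (*-comm (s (suc (k ∸ j))) _) (ratio-antitone (∸-monoʳ-≤ k i≤j))

conv-logConcave : ∀ {Ds Dt s t} → PositiveLC Ds s → PositiveLC Dt t →
  ∀ k → conv s t k * conv s t (2 + k) ≤ conv s t (1 + k) * conv s t (1 + k)
conv-logConcave {s = s} {t} hs ht k = begin
    conv s t k * conv s t (2 + k)
  ≡⟨ cong₂ _*_ (conv-toeplitz s t (n≤1+n (suc k))) (conv-toeplitz s t ≤-refl) ⟩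
    ∑< (3 + k) (λ i → s⁻ i * t₁ i) * ∑< (3 + k) (λ i → s i * t₂ i)
  ≤⟨ ∑<-antitoneRatio (3 + k) {a = s⁻} {b = s} {u = t₁} {v = t₂}
       (shift-antitoneRatio hs) (toeplitz-antitoneRatio ht (1 + k)) ⟩
    ∑< (3 + k) (λ i → s i * t₁ i) * ∑< (3 + k) (λ i → s⁻ i * t₂ i)
  ≡⟨ cong₂ _*_ (conv-toeplitz s t (n≤1+n (2 + k))) (conv-toeplitz s t ≤-refl) ⟨
    conv s t (1 + k) * conv s t (1 + k) ∎
  where
  open ≤-Reasoning
  -- conv s t (1 + k) is expanded both against s and against its shift s⁻.
  s⁻ t₁ t₂ : ℕ → ℕ
  s⁻ i = toeplitz s i 1
  t₁ = toeplitz t (1 + k)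
  t₂ = toeplitz t (2 + k)

ind : Bool → ℕ
ind b = if b then 1 else 0

-- Distances in a graph

descend-to-boundary : ∀ {P : ℕ → Set} → (∀ k → Dec (P k)) → ∀ {k} → P k →
  ∃ λ d → P d × (∀ {e} → d ≡ suc e → ¬ P e)
descend-to-boundary P? {zero}  p = 0 , p , λ ()
descend-to-boundary P? {suc k} p with P? k
... | yes p' = descend-to-boundary P? p'
... | no ¬p' = suc k , p , λ { refl → ¬p' }

∨-true⁻ : ∀ a {b} → a ∨ b ≡ true → a ≡ true ⊎ b ≡ true
∨-true⁻ true  _ = inj₁ refl
∨-true⁻ false e = inj₂ e

not-true⁻ : ∀ {b} → not b ≡ true → b ≢ true
not-true⁻ {false} _ ()

any-allFin⁺ : ∀ {n} (p : Fin n → Bool) {i} → p i ≡ true → any p (allFin n) ≡ true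
any-allFin⁺ p {i} e = Equivalence.to T-≡ (any⁺ p (tabulate⁺ i (Equivalence.from T-≡ e)))

any-allFin⁻ : ∀ {n} (p : Fin n → Bool) → any p (allFin n) ≡ true → ∃ λ i → p i ≡ true
any-allFin⁻ p e with i , pi ← tabulate⁻ (any⁻ p _ (Equivalence.from T-≡ e)) = i , Equivalence.to T-≡ pi

≟-true⁺ : ∀ {n} {x y : Fin n} → x ≡ y → ⌊ x Fin.≟ y ⌋ ≡ true
≟-true⁺ x≡y = Equivalence.to T-≡ (fromWitness x≡y)

≟-true⁻ : ∀ {n} {x y : Fin n} → ⌊ x Fin.≟ y ⌋ ≡ true → x ≡ y
≟-true⁻ e = toWitness (Equivalence.from T-≡ e)

module _ {G : Graph} where

  reach-refl : ∀ x → reach G 0 x x ≡ true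
  reach-refl x = ≟-true⁺ refl

  reach-weaken : ∀ {k x y} → reach G k x y ≡ true → reach G (suc k) x y ≡ true
  reach-weaken {k} {x} {y} r = cong (_∨ any (λ z → adj G x z ∧ reach G k z y) (allFin (order G))) r

  reach-mono : ∀ {k k' x y} → k ≤ k' → reach G k x y ≡ true → reach G k' x y ≡ true
  reach-mono k≤k' = go (≤⇒≤′ k≤k')
    where
    go : ∀ {k k' x y} → k ≤′ k' → reach G k x y ≡ true → reach G k' x y ≡ true
    go ≤′-refl          r = r
    go (≤′-step {k'} k≤′k') r = reach-weaken {k'} (go k≤′k' r)

  reach-step : ∀ {k x z y} → adj G x z ≡ true → reach G k z y ≡ true → reach G (suc k) x y ≡ true
  reach-step {k} {x} {z} {y} xz r =
    trans (cong (reach G k x y ∨_) (any-allFin⁺ (λ w → adj G x w ∧ reach G k w y) (cong₂ _∧_ xz r)))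
          (∨-zeroʳ _)

  reach-suc⁻ : ∀ {k x y} → reach G (suc k) x y ≡ true →
    reach G k x y ≡ true ⊎ ∃ λ z → adj G x z ≡ true × reach G k z y ≡ true
  reach-suc⁻ {k} {x} {y} r with ∨-true⁻ (reach G k x y) r
  ... | inj₁ r' = inj₁ r'
  ... | inj₂ e with z , e' ← any-allFin⁻ (λ w → adj G x w ∧ reach G k w y) e =
    inj₂ (z , ∧-conicalˡ _ _ e' , ∧-conicalʳ _ _ e')

  atDist⇒reach : ∀ {d x y} → atDist G d x y ≡ true → reach G d x y ≡ true
  atDist⇒reach {zero}  at = at
  atDist⇒reach {suc d} at = ∧-conicalˡ _ _ at

  atDist-suc : ∀ {d x y} → reach G (suc d) x y ≡ true → reach G d x y ≡ false → atDist G (suc d) x y ≡ true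
  atDist-suc r r' = cong₂ _∧_ r (cong not r')

  atDist-minimal : ∀ {d k x y} → atDist G d x y ≡ true → reach G k x y ≡ true → d ≤ k
  atDist-minimal {zero}          _  _ = z≤n
  atDist-minimal {suc d} {k} {x} {y} at r with suc d ≤? k
  ... | yes d<k = d<k
  ... | no  d≮k = contradiction (reach-mono (≤-pred (≰⇒> d≮k)) r) (not-true⁻ (∧-conicalʳ _ _ at))

  atDist-intro : ∀ {d x y} → reach G d x y ≡ true → (∀ {k} → reach G k x y ≡ true → d ≤ k) →
    atDist G d x y ≡ true
  atDist-intro {zero}  r _       = r
  atDist-intro {suc d} r minimal = atDist-suc {d} r (¬-not (λ r' → 1+n≰n (minimal {d} r')))

  atDist-unique : ∀ {d d' x y} → atDist G d x y ≡ true → atDist G d' x y ≡ true → d ≡ d'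
  atDist-unique {d} {d'} at at' =
    ≤-antisym (atDist-minimal at (atDist⇒reach {d'} at')) (atDist-minimal at' (atDist⇒reach {d} at))

  atDist-exists : ∀ {k x y} → reach G k x y ≡ true → ∃ λ d → atDist G d x y ≡ true
  atDist-exists {zero}          r = 0 , r
  atDist-exists {suc k} {x} {y} r with reach G k x y Bool.≟ true
  ... | yes r' = atDist-exists {k} r'
  ... | no  r' = suc k , atDist-suc {k} r (¬-not r')

  atDist-δ : ∀ {d x y} → atDist G d x y ≡ true → ∀ i → ind (atDist G i x y) ≡ δ d i
  atDist-δ {d} at i with i ≟ d
  ... | yes refl = trans (cong ind at) (sym (δ-diag d))
  ... | no  i≢d  = trans (cong ind (¬-not (λ at' → i≢d (atDist-unique at' at)))) (sym (δ-off i≢d))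

  atDist-pred : ∀ {i x y} → atDist G (suc i) x y ≡ true → ∃ λ z → atDist G i z y ≡ true
  atDist-pred {i} at with reach-suc⁻ {i} (atDist⇒reach {suc i} at)
  ... | inj₁ r           = contradiction (atDist-minimal {suc i} {i} at r) 1+n≰n
  ... | inj₂ (z , xz , r) =
    z , atDist-intro {i} r (λ {k} r' → ≤-pred (atDist-minimal {suc i} {suc k} at (reach-step {k} xz r')))

  atDist-descend : ∀ {i d x y} → i ≤ d → atDist G d x y ≡ true → ∃ λ z → atDist G i z y ≡ true
  atDist-descend i≤d = go (≤⇒≤′ i≤d)
    where
    go : ∀ {i d x y} → i ≤′ d → atDist G d x y ≡ true → ∃ λ z → atDist G i z y ≡ true
    go ≤′-refl         at = _ , at
    go (≤′-step {d} i≤′d) at = go i≤′d (proj₂ (atDist-pred {d} at))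

  sphere-sum : ∀ i x → sphere G i x ≡ ∑[ y < order G ] ind (atDist G i x y)
  sphere-sum i x =
    trans (cong List.sum (map-tabulate (λ y → y) (ind ∘ atDist G i x))) (sum-tabulate (ind ∘ atDist G i x))

  atDist⇒sphere-pos : ∀ {i x y} → atDist G i x y ≡ true → 0 < sphere G i x
  atDist⇒sphere-pos {i} {x} {y} at =
    subst (0 <_) (sym (sphere-sum i x))
          (≤-trans (≤-reflexive (cong ind (sym at))) (term≤sum (ind ∘ atDist G i x) y))

  sphere-vanish : ∀ {k i x} → (∀ y → reach G k x y ≡ true) → k < i → sphere G i x ≡ 0
  sphere-vanish {k} {i} {x} reach-k k<i = trans (sphere-sum i x) (sum-zero (ind ∘ atDist G i x) far)
    where
    far : ∀ y → ind (atDist G i x y) ≡ 0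
    far y = cong ind (¬-not (λ at → <⇒≱ k<i (atDist-minimal {i} {k} at (reach-k y))))

  IsDiameter-unique : ∀ {d d'} → IsDiameter G d → IsDiameter G d' → d ≡ d'
  IsDiameter-unique {d} {d'} (reach-d , x , y , at) (reach-d' , x' , y' , at') =
    ≤-antisym (atDist-minimal {d} {d'} at (reach-d' x y)) (atDist-minimal {d'} {d} at' (reach-d x' y'))

  IsDiameter⇒Connected : ∀ {d} → IsDiameter G d → Connected G
  IsDiameter⇒Connected {d} (reach-d , _) x y = d , reach-d x y

  IsDiameter⇒sphere-pos : ∀ {d i} → IsDiameter G d → i ≤ d → ∃ λ x → 0 < sphere G i x
  IsDiameter⇒sphere-pos {d} {i} (_ , _ , y , at) i≤d with z , at' ← atDist-descend {i} {d} i≤d at =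
    z , atDist⇒sphere-pos {i} at'

  IsDiameter⇒sphere-vanish : ∀ {d i x} → IsDiameter G d → d < i → sphere G i x ≡ 0
  IsDiameter⇒sphere-vanish {x = x} (reach-d , _) = sphere-vanish (reach-d x)

  ReachableWithin : ℕ → Set
  ReachableWithin k = ∀ x y → reach G k x y ≡ true

  reachableWithin? : ∀ k → Dec (ReachableWithin k)
  reachableWithin? k = all? (λ x → all? (λ y → reach G k x y Bool.≟ true))

  Connected⇒reachableWithin : Connected G → ∃ ReachableWithin
  Connected⇒reachableWithin conn = K , λ x y → reach-mono {k = d x y} {K} (d≤K x y) (proj₂ (conn x y))
    where
    d : Fin (order G) → Fin (order G) → ℕ
    d x y = proj₁ (conn x y)
    K = ∑[ x < order G ] ∑[ y < order G ] d x y
    d≤K : ∀ x y → d x y ≤ K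
    d≤K x y = ≤-trans (term≤sum (d x) y) (term≤sum (λ x → ∑[ y < order G ] d x y) x)

  -- The diameter is the least radius within which every pair is reachable; search down for it from
  -- the sum of the lengths that Connected provides.
  diameter-exists : Connected G → Fin (order G) → ∃ (IsDiameter G)
  diameter-exists conn x₀
    with K , within-K ← Connected⇒reachableWithin conn
    with descend-to-boundary {ReachableWithin} reachableWithin? {K} within-K
  ... | zero  , within-0 , _ = 0 , within-0 , x₀ , x₀ , reach-refl x₀
  ... | suc e , within-d , not-within-e
    with x , ¬within-x ← ¬∀⟶∃¬ (order G) _ (λ x → all? (λ y → reach G e x y Bool.≟ true)) (not-within-e refl)
    with y , ¬reach ← ¬∀⟶∃¬ (order G) _ (λ y → reach G e x y Bool.≟ true) ¬within-x =
    suc e , within-d , x , y , atDist-suc {d = e} (within-d x y) (¬-not ¬reach)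

-- Cartesian products

module _ {G H : Graph} where
  private
    m = order G
    n = order H
    π₁ : Fin (m * n) → Fin m
    π₁ p = proj₁ (remQuot {m} n p)
    π₂ : Fin (m * n) → Fin n
    π₂ p = proj₂ (remQuot {m} n p)

  combine-elim : ∀ {P : Fin (m * n) → Set} → (∀ u v → P (combine u v)) → ∀ p → P p
  combine-elim {P} h p = subst P (combine-remQuot {m} n p) (h (π₁ p) (π₂ p))

  π₁-combine : ∀ u v → π₁ (combine u v) ≡ u
  π₁-combine u v = cong proj₁ (remQuot-combine {m} {n} u v)

  π₂-combine : ∀ u v → π₂ (combine u v) ≡ v
  π₂-combine u v = cong proj₂ (remQuot-combine {m} {n} u v)

  adj-□-combine : ∀ (u u' : Fin m) (v v' : Fin n) →
    adj (G □ H) (combine u v) (combine u' v') ≡ (⌊ u Fin.≟ u' ⌋ ∧ adj H v v') ∨ (⌊ v Fin.≟ v' ⌋ ∧ adj G u u')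
  adj-□-combine u u' v v' = cong₂ (λ p q → (⌊ proj₁ p Fin.≟ proj₁ q ⌋ ∧ adj H (proj₂ p) (proj₂ q))
                                         ∨ (⌊ proj₂ p Fin.≟ proj₂ q ⌋ ∧ adj G (proj₁ p) (proj₁ q)))
                                  (remQuot-combine {m} {n} u v) (remQuot-combine {m} {n} u' v')

  □-adjʳ : ∀ (u : Fin m) {v v'} → adj H v v' ≡ true → adj (G □ H) (combine u v) (combine u v') ≡ true
  □-adjʳ u {v} {v'} vv' =
    trans (adj-□-combine u u v v') (cong (_∨ (⌊ v Fin.≟ v' ⌋ ∧ adj G u u)) (cong₂ _∧_ (≟-true⁺ refl) vv'))

  □-adjˡ : ∀ {u u'} (v : Fin n) → adj G u u' ≡ true → adj (G □ H) (combine u v) (combine u' v) ≡ true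
  □-adjˡ {u} {u'} v uu' = trans (adj-□-combine u u' v v)
    (trans (cong ((⌊ u Fin.≟ u' ⌋ ∧ adj H v v) ∨_) (cong₂ _∧_ (≟-true⁺ refl) uu')) (∨-zeroʳ _))

  □-adj⁻ : ∀ {p q} → adj (G □ H) p q ≡ true →
    (π₁ p ≡ π₁ q × adj H (π₂ p) (π₂ q) ≡ true) ⊎ (π₂ p ≡ π₂ q × adj G (π₁ p) (π₁ q) ≡ true)
  □-adj⁻ {p} {q} pq with ∨-true⁻ (⌊ π₁ p Fin.≟ π₁ q ⌋ ∧ adj H (π₂ p) (π₂ q)) pq
  ... | inj₁ e = inj₁ (≟-true⁻ (∧-conicalˡ _ _ e) , ∧-conicalʳ _ _ e)
  ... | inj₂ e = inj₂ (≟-true⁻ (∧-conicalˡ _ _ e) , ∧-conicalʳ _ _ e)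

  reach-□⁻ : ∀ {k p q} → reach (G □ H) k p q ≡ true →
    ∃₂ λ a b → a + b ≤ k × reach G a (π₁ p) (π₁ q) ≡ true × reach H b (π₂ p) (π₂ q) ≡ true
  reach-□⁻ {zero} {p} r with refl ← ≟-true⁻ {x = p} r =
    0 , 0 , z≤n , reach-refl {G} (π₁ p) , reach-refl {H} (π₂ p)
  reach-□⁻ {suc k} {p} {q} r with reach-suc⁻ {G □ H} {k} r
  ... | inj₁ r' with a , b , a+b≤k , ra , rb ← reach-□⁻ {k} r' = a , b , m≤n⇒m≤1+n a+b≤k , ra , rb
  ... | inj₂ (z , pz , r') with a , b , a+b≤k , ra , rb ← reach-□⁻ {k} r' | □-adj⁻ {p} {z} pz
  ...   | inj₁ (π₁p≡π₁z , adjH) =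
    a , suc b , subst (_≤ suc k) (sym (+-suc a b)) (s≤s a+b≤k) ,
    subst (λ w → reach G a w (π₁ q) ≡ true) (sym π₁p≡π₁z) ra , reach-step {H} {b} adjH rb
  ...   | inj₂ (π₂p≡π₂z , adjG) =
    suc a , b , s≤s a+b≤k , reach-step {G} {a} adjG ra ,
    subst (λ w → reach H b w (π₂ q) ≡ true) (sym π₂p≡π₂z) rb

  reach-□ʳ : ∀ {b} (u : Fin m) {v v'} → reach H b v v' ≡ true →
    reach (G □ H) b (combine u v) (combine u v') ≡ true
  reach-□ʳ {zero}  u {v} r with refl ← ≟-true⁻ {x = v} r = reach-refl {G □ H} (combine u v)
  reach-□ʳ {suc b} u {v} {v'} r with reach-suc⁻ {H} {b} r
  ... | inj₁ r'            = reach-weaken {G □ H} {b} (reach-□ʳ {b} u r')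
  ... | inj₂ (w , vw , r') = reach-step {G □ H} {b} (□-adjʳ u vw) (reach-□ʳ {b} u {w} {v'} r')

  reach-□⁺ : ∀ {a b} {u u' : Fin m} {v v' : Fin n} → reach G a u u' ≡ true → reach H b v v' ≡ true →
    reach (G □ H) (a + b) (combine u v) (combine u' v') ≡ true
  reach-□⁺ {zero} {b} {u} ra rb with refl ← ≟-true⁻ {x = u} ra = reach-□ʳ {b} u rb
  reach-□⁺ {suc a} {b} ra rb with reach-suc⁻ {G} {a} ra
  ... | inj₁ r'            = reach-weaken {G □ H} {a + b} (reach-□⁺ {a} r' rb)
  ... | inj₂ (w , uw , r') = reach-step {G □ H} {a + b} (□-adjˡ _ uw) (reach-□⁺ {a} r' rb)

  atDist-□ : ∀ {a b} {u u' : Fin m} {v v' : Fin n} → atDist G a u u' ≡ true → atDist H b v v' ≡ true →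
    atDist (G □ H) (a + b) (combine u v) (combine u' v') ≡ true
  atDist-□ {a} {b} {u} {u'} {v} {v'} atG atH =
    atDist-intro {G □ H} {a + b} (reach-□⁺ {a} {b} (atDist⇒reach {G} {a} atG) (atDist⇒reach {H} {b} atH))
                 minimal
    where
    minimal : ∀ {k} → reach (G □ H) k (combine u v) (combine u' v') ≡ true → a + b ≤ k
    minimal {k} r with a' , b' , a'+b'≤k , ra , rb ← reach-□⁻ {k} r = ≤-trans (+-mono-≤ a≤a' b≤b') a'+b'≤k
      where
      a≤a' : a ≤ a'
      a≤a' = atDist-minimal {G} {a} {a'} atG
               (subst₂ (λ x y → reach G a' x y ≡ true) (π₁-combine u v) (π₁-combine u' v') ra)
      b≤b' : b ≤ b'
      b≤b' = atDist-minimal {H} {b} {b'} atH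
               (subst₂ (λ x y → reach H b' x y ≡ true) (π₂-combine u v) (π₂-combine u' v') rb)

  IsDiameter-□ : ∀ {a b} → IsDiameter G a → IsDiameter H b → IsDiameter (G □ H) (a + b)
  IsDiameter-□ {a} {b} (reach-a , x , y , atG) (reach-b , x' , y' , atH) =
    reach-all , combine x x' , combine y y' , atDist-□ {a} {b} atG atH
    where
    reach-all : ∀ p q → reach (G □ H) (a + b) p q ≡ true
    reach-all p = combine-elim {λ q → reach (G □ H) (a + b) p q ≡ true} λ u' v' →
      combine-elim {λ p → reach (G □ H) (a + b) p (combine u' v') ≡ true}
        (λ u v → reach-□⁺ {a} {b} (reach-a u u') (reach-b v v')) p

  sphere-□ : Connected G → Connected H → ∀ i u v →
    sphere (G □ H) i (combine u v) ≡ conv (λ a → sphere G a u) (λ b → sphere H b v) i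
  sphere-□ conn-G conn-H i u v = begin
      sphere (G □ H) i (combine u v)
    ≡⟨ sphere-sum i (combine u v) ⟩
      ∑[ p < m * n ] ind (atDist (G □ H) i (combine u v) p)
    ≡⟨ sum-combine m (ind ∘ atDist (G □ H) i (combine u v)) ⟩
      ∑[ u' < m ] ∑[ v' < n ] ind (atDist (G □ H) i (combine u v) (combine u' v'))
    ≡⟨ sum-cong-≗ {m} {λ u' → ∑[ v' < n ] ind (atDist (G □ H) i (combine u v) (combine u' v'))}
         (λ u' → sum-cong-≗ {n} {λ v' → ind (atDist (G □ H) i (combine u v) (combine u' v'))} (split u')) ⟩
      ∑[ u' < m ] ∑[ v' < n ] conv (indG u') (indH v') i
    ≡⟨ conv-∑∑ indG indH i ⟩
      conv (λ a → ∑[ u' < m ] indG u' a) (λ b → ∑[ v' < n ] indH v' b) i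
    ≡⟨ conv-cong (λ a → sphere-sum {G} a u) (λ b → sphere-sum {H} b v) i ⟨
      conv (λ a → sphere G a u) (λ b → sphere H b v) i ∎
    where
    open ≡-Reasoning
    indG : Fin m → ℕ → ℕ
    indG u' a = ind (atDist G a u u')
    indH : Fin n → ℕ → ℕ
    indH v' b = ind (atDist H b v v')
    split : ∀ u' v' → ind (atDist (G □ H) i (combine u v) (combine u' v')) ≡ conv (indG u') (indH v') i
    split u' v' with dG , atG ← atDist-exists {G} {proj₁ (conn-G u u')} (proj₂ (conn-G u u'))
                   | dH , atH ← atDist-exists {H} {proj₁ (conn-H v v')} (proj₂ (conn-H v v')) = begin
        ind (atDist (G □ H) i (combine u v) (combine u' v'))
      ≡⟨ atDist-δ {G □ H} {dG + dH} (atDist-□ {dG} {dH} atG atH) i ⟩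
        δ (dG + dH) i
      ≡⟨ conv-δ dG dH i ⟨
        conv (δ dG) (δ dH) i
      ≡⟨ conv-cong (atDist-δ {G} {dG} atG) (atDist-δ {H} {dH} atH) i ⟨
        conv (indG u') (indH v') i ∎

-- Graphs with a common log-concave sphere sequence

record LCRegular (G : Graph) : Set where
  field
    diameter   : ℕ
    isDiameter : IsDiameter G diameter
    spheres    : ℕ → ℕ
    sphere≡    : ∀ i x → sphere G i x ≡ spheres i
    logConcave : LogConcave diameter spheres

  centre : Fin (order G)
  centre = proj₁ (proj₂ isDiameter)

  positiveLC : PositiveLC diameter spheres
  positiveLC = record
    { positive   = λ {i} i≤d → let x , pos = IsDiameter⇒sphere-pos {G} isDiameter i≤d in
                               subst (0 <_) (sphere≡ i x) pos
    ; vanish     = λ {i} d<i → trans (sym (sphere≡ i centre)) (IsDiameter⇒sphere-vanish {G} isDiameter d<i)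
    ; logConcave = logConcave
    }

  distanceDegreeRegular : DistanceDegreeRegular G
  distanceDegreeRegular _ _ i _ x y = trans (sphere≡ i x) (sym (sphere≡ i y))

  lc : LC G
  lc = centre , λ d isDiameter' →
    subst (λ d → LogConcave d (λ i → sphere G i centre)) (IsDiameter-unique {G} isDiameter isDiameter')
          (LogConcave-cong (λ i → sym (sphere≡ i centre)) logConcave)

LCRegular-□ : ∀ {G H} → LCRegular G → LCRegular H → LCRegular (G □ H)
LCRegular-□ {G} {H} g h = record
  { diameter   = G.diameter + H.diameter
  ; isDiameter = IsDiameter-□ {G} {H} {G.diameter} {H.diameter} G.isDiameter H.isDiameter
  ; spheres    = conv G.spheres H.spheres
  ; sphere≡    = λ i → combine-elim {G} {H} λ u v →
      trans (sphere-□ G-connected H-connected i u v) (conv-cong (λ a → G.sphere≡ a u) (λ b → H.sphere≡ b v) i)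
  ; logConcave = λ { (suc k) _ _ → conv-logConcave G.positiveLC H.positiveLC k }
  }
  where
  module G = LCRegular g
  module H = LCRegular h
  G-connected = IsDiameter⇒Connected {G} {G.diameter} G.isDiameter
  H-connected = IsDiameter⇒Connected {H} {H.diameter} H.isDiameter

LCRegular-^□ : ∀ {A} → LCRegular A → ∀ n → LCRegular (A ^□ n)
LCRegular-^□ a zero          = a
LCRegular-^□ a (suc zero)    = a
LCRegular-^□ a (suc (suc n)) = LCRegular-□ (LCRegular-^□ a (suc n)) a

LCRegular-intro : ∀ {A} → Connected A → DistanceDegreeRegular A → LC A → LCRegular A
LCRegular-intro {A} conn ddr (x₀ , lc-x₀) with D , isD ← diameter-exists conn x₀ = record
  { diameter   = D
  ; isDiameter = isD
  ; spheres    = λ i → sphere A i x₀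
  ; sphere≡    = sphere≡
  ; logConcave = lc-x₀ D isD
  }
  where
  sphere≡ : ∀ i x → sphere A i x ≡ sphere A i x₀
  sphere≡ i x with i ≤? D
  ... | yes i≤D = ddr D isD i i≤D x x₀
  ... | no  i≰D = trans (vanish x) (sym (vanish x₀))
    where
    vanish : ∀ y → sphere A i y ≡ 0
    vanish y = IsDiameter⇒sphere-vanish {A} {x = y} isD (≰⇒> i≰D)

corollary2 : (A : Graph) → Simple A → Connected A →
    DistanceDegreeRegular A → LC A →
    ∀ (n : ℕ) → 1 ≤ n → DistanceDegreeRegular (A ^□ n) × LC (A ^□ n)
corollary2 A _ conn ddr lcA n _ = distanceDegreeRegular , lc
  where open LCRegular (LCRegular-^□ (LCRegular-intro conn ddr lcA) n)
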